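{- For any nonempty symmetric set $S\subseteq\{0,1\}^n$, we have \[ \mathrm{inn}_n(\{0,1\}^n\setminus S)+\mathrm{out}_n(S)\ge n. \] Further, equality holds if and only if either $S$ or $\{0,1\}^n\setminus S$ is a peripheral interval.
   Context: For integers $a\le b$, $[a,b]$ denotes the set of integers between $a$ and $b$ (empty if $a>b$). The Hamming weight of $x\in\{0,1\}^n$ is $|x|=|\{i:x_i=1\}|$. A set $S\subseteq\{0,1\}^n$ is symmetric if it is closed under permutations of coordinates; then $W_n(S)=\{|x|:x\in S\}$ determines $S$. For $i\in[0,n]$, $W_{n,i}=[0,i-1]\cup[n-i+1,n]$. For $a\in[-1,n-1]$, $b\in[1,n+1]$, $a<b$, let $I_{n,a,b}=[0,a]\cup[b,n]$ (with $[0,-1]=[n+1,n]=\emptyset$); the peripheral interval $J_{n,a,b}$ is the symmetric set with $W_n(J_{n,a,b})=I_{n,a,b}$. For a symmetric $S\subsetneq\{0,1\}^n$, its inner interval $\mathrm{innint}(S)$ is the peripheral interval $J_{n,a,b}\subseteq S$ of maximum size (this is unique); also $\mathrm{innint}(\{0,1\}^n)=J_{n,\lfloor n/2\rfloor,\lfloor n/2\rfloor+1}$. For symmetric $S$, let $\mathcal O(S)$ be the set of peripheral intervals $J_{n,a,b}\supseteq S$ with $|I_{n,a,b}|$ minimum; among these, the minimizer of $|a+b-n|$ is either a unique $J_{n,a,b}$, in which case $\mathrm{outint}(S)=J_{n,a,b}$, or exactly a pair $J_{n,a,b},J_{n,n-b,n-a}$, in which case $\mathrm{outint}(S)=J_{n,a,b}$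 for the one with $a>n-b$. Define $\mathrm{inn}_n(S)=(\min\{a,n-b\}+1)+|W_n(S)\setminus W_{n,\min\{a,n-b\}+1}|$ where $J_{n,a,b}=\mathrm{innint}(S)$, and $\mathrm{out}_n(S)=a+n-b+1$ where $J_{n,a,b}=\mathrm{outint}(S)$. -}

module Defs where

open import Data.Bool using (Bool; true; false; _∨_; if_then_else_)
open import Data.Nat as ℕ using (ℕ; suc; _∸_)
open import Data.Nat.Combinatorics using (_C_)
open import Data.Fin using (Fin; toℕ)
open import Data.Fin.Subset using (Subset; _⊆_; ∁; _∩_; ∣_∣; ⊤)
open import Data.Vec using (tabulate; lookup; sum)
open import Data.Integer as ℤ using (ℤ; +_; -[1+_]; _+_; _-_; _⊓_)
open import Data.Product using (Σ; _×_; _,_)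
open import Relation.Nullary using (¬_)
open import Relation.Nullary.Decidable using (⌊_⌋)
open import Relation.Binary.PropositionalEquality using (_≡_; _≢_)

-- A symmetric set S ⊆ {0,1}^n is represented by its weight set
-- W_n(S) ⊆ [0,n], as a subset of Fin (suc n) (weight k ↔ Fin element with toℕ = k).
SymSet : ℕ → Set
SymSet n = Subset (suc n)

Valid : ℕ → ℤ → ℤ → Set
Valid n a b = (-[1+ 0 ] ℤ.≤ a) × (a ℤ.< + n) × (+ 1 ℤ.≤ b) × (b ℤ.≤ + suc n) × (a ℤ.< b)

-- I_{n,a,b} = [0,a] ∪ [b,n], i.e. W_n(J_{n,a,b}).
I : (n : ℕ) → ℤ → ℤ → SymSet n
I n a b = tabulate λ k → ⌊ + toℕ k ℤ.≤? a ⌋ ∨ ⌊ b ℤ.≤? + toℕ k ⌋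

Wni : (n : ℕ) → ℤ → SymSet n
Wni n i = tabulate λ k → ⌊ + toℕ k ℤ.<? i ⌋ ∨ ⌊ (+ n - i) ℤ.<? + toℕ k ⌋

-- number of elements of {0,1}^n in the symmetric set with weight set W
size : (n : ℕ) → SymSet n → ℕ
size n W = sum (tabulate λ k → if lookup W k then n C toℕ k else 0)

Peripheral : (n : ℕ) → SymSet n → Set
Peripheral n S = Σ ℤ λ a → Σ ℤ λ b → Valid n a b × S ≡ I n a b

IsInnint : (n : ℕ) → SymSet n → ℤ → ℤ → Set
IsInnint n T a b =
  (T ≡ ⊤ → (a ≡ + (n ℕ./ 2)) × (b ≡ + (n ℕ./ 2) + + 1))
  × (¬ (T ≡ ⊤) →
      Valid n a b × I n a b ⊆ T
      × (∀ a' b' → Valid n a' b' → I n a' b' ⊆ T → size n (I n a' b') ℕ.≤ size n (I n a b)))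

InO : (n : ℕ) → SymSet n → ℤ → ℤ → Set
InO n S a b =
  Valid n a b × S ⊆ I n a b
  × (∀ a' b' → Valid n a' b' → S ⊆ I n a' b' → ∣ I n a b ∣ ℕ.≤ ∣ I n a' b' ∣)

IsOutint : (n : ℕ) → SymSet n → ℤ → ℤ → Set
IsOutint n S a b =
  InO n S a b
  × (∀ a' b' → InO n S a' b' → ℤ.∣ a + b - + n ∣ ℕ.≤ ℤ.∣ a' + b' - + n ∣)
  × (∀ a' b' → InO n S a' b' → ℤ.∣ a' + b' - + n ∣ ≡ ℤ.∣ a + b - + n ∣
       → (a' , b') ≢ (a , b) → (+ n - b) ℤ.< a)

-- inn_n(T), given innint(T) = J_{n,a,b}
inn : (n : ℕ) → SymSet n → ℤ → ℤ → ℤ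
inn n T a b = (m + + 1) + + ∣ T ∩ ∁ (Wni n (m + + 1)) ∣
  where m = a ⊓ (+ n - b)

-- out_n(S), given outint(S) = J_{n,a,b}
out : ℕ → ℤ → ℤ → ℤ
out n a b = a + + n - b + + 1

-- Let T = ∁ S, let innint(T) have weight set [0, A) ∪ [B, n] and
-- put μ = min(A, n + 1 − B): T contains the rim [0, μ) ∪ [n + 1 − μ, n], and inn(T) = μ + X where X counts T
-- in the middle [μ, n + 1 − μ).  If outint(S) has weight set [0, C) ∪ [D, n], then the gap [C, D) lies in T
-- and out(S) = n − (D − C), so the claim is D − C ≤ μ + X.  A weight k₀ of S lies in the middle and not in
-- the gap, so the gap lies on one side of k₀: its part in the middle is counted by X, and its part outside
-- the middle lies in one half of the rim, of size μ.  Equality forces the gap to contain T's middle part and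
-- that whole half of the rim, which makes S (when μ = 0) or T peripheral.  Conversely, a peripheral S forces
-- μ = 0 and X = D − C, and a peripheral T is its own inner interval, whence μ + X = max(A, n + 1 − B) ≤ D − C.
module Submission where

open import Defs

module WeightSets where

  open import Algebra.Properties.CommutativeSemigroup using (interchange)
  open import Data.Bool using (Bool; true; false; not; _∧_; T; if_then_else_)
  open import Data.Bool.Properties using (T-∧; not-involutive)
  open import Data.Empty using (⊥-elim)
  open import Data.Fin using (toℕ; fromℕ<)
  open import Data.Fin.Properties using (toℕ<n; toℕ-fromℕ<; fromℕ<-toℕ)
  open import Data.Fin.Subset using (_⊆_; ∁; _∩_; ∣_∣; _∈_)
  open import Data.Nat
    using (ℕ; zero; suc; pred; _+_; _∸_; _⊓_; _⊔_; _≟_; _≤_; _<_; _≤ᵇ_; _<ᵇ_; _≤?_; z≤n; s≤s; s≤s⁻¹; z<s; s<s)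
  open import Data.Nat.Combinatorics using (nCk+nC[k+1]≡[n+1]C[k+1]) renaming (_C_ to _choose_)
  open import Data.Nat.Properties
  open import Data.Product using (_×_; _,_; proj₁; proj₂; ∃₂)
  open import Data.Sum using (_⊎_; inj₁; inj₂; [_,_]′; map₂)
  open import Data.Unit using (tt)
  open import Data.Vec using (Vec; []; _∷_; tabulate; lookup; sum; here; there)
  open import Function using (_∘_; const; mk⇔; Equivalence)
  open import Relation.Binary.PropositionalEquality
  open import Relation.Nullary using (¬_; yes; no)
  open import Relation.Nullary.Decidable using (T?; does-⇔; decidable-stable)

  open Equivalence using (to; from)

  T-⇔⇒≡ : ∀ {x y} → (T x → T y) → (T y → T x) → x ≡ y
  T-⇔⇒≡ f g = does-⇔ (mk⇔ f g) (T? _) (T? _)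

  not⁺ : ∀ {x} → ¬ T x → T (not x)
  not⁺ {true}  ¬x = ¬x tt
  not⁺ {false} _  = tt

  not⁻ : ∀ {x} → T (not x) → ¬ T x
  not⁻ {true} ()

  ∁ₚ : (ℕ → Bool) → ℕ → Bool
  ∁ₚ p k = not (p k)

  infixr 7 _∩ₚ_
  _∩ₚ_ : (ℕ → Bool) → (ℕ → Bool) → ℕ → Bool
  (p ∩ₚ q) k = p k ∧ q k

  infix 4 _⊆[_]_ _≐[_]_
  _⊆[_]_ : (ℕ → Bool) → ℕ → (ℕ → Bool) → Set
  p ⊆[ N ] q = ∀ {k} → k < N → T (p k) → T (q k)

  _≐[_]_ : (ℕ → Bool) → ℕ → (ℕ → Bool) → Set
  p ≐[ N ] q = ∀ {k} → k < N → p k ≡ q k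

  ⊆-antisym : ∀ {N p q} → p ⊆[ N ] q → q ⊆[ N ] p → p ≐[ N ] q
  ⊆-antisym p⊆q q⊆p k<N = T-⇔⇒≡ (p⊆q k<N) (q⊆p k<N)

  ≐-sym : ∀ {N p q} → p ≐[ N ] q → q ≐[ N ] p
  ≐-sym p≐q k<N = sym (p≐q k<N)

  ⊆-resp-≐ : ∀ {N p p′ q q′} → p ≐[ N ] p′ → q ≐[ N ] q′ → p ⊆[ N ] q → p′ ⊆[ N ] q′
  ⊆-resp-≐ p≐p′ q≐q′ p⊆q k<N = subst T (q≐q′ k<N) ∘ p⊆q k<N ∘ subst T (sym (p≐p′ k<N))

  ≐⇒⊆ : ∀ {N p q} → p ≐[ N ] q → p ⊆[ N ] q
  ≐⇒⊆ p≐q k<N = subst T (p≐q k<N)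

  ≐⇒⊇ : ∀ {N p q} → p ≐[ N ] q → q ⊆[ N ] p
  ≐⇒⊇ p≐q k<N = subst T (sym (p≐q k<N))

  wcount : ℕ → (ℕ → ℕ) → (ℕ → Bool) → ℕ
  wcount zero    w p = 0
  wcount (suc N) w p = (if p 0 then w 0 else 0) + wcount N (w ∘ suc) (p ∘ suc)

  count : ℕ → (ℕ → Bool) → ℕ
  count N = wcount N (const 1)

  wcount-cong : ∀ N w {p q} → p ≐[ N ] q → wcount N w p ≡ wcount N w q
  wcount-cong zero    w p≐q = refl
  wcount-cong (suc N) w p≐q =
    cong₂ (λ b c → (if b then w 0 else 0) + c) (p≐q z<s) (wcount-cong N (w ∘ suc) (p≐q ∘ s<s))

  wcount-split : ∀ N w p q → wcount N w p ≡ wcount N w (p ∩ₚ q) + wcount N w (p ∩ₚ ∁ₚ q)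
  wcount-split zero    w p q = refl
  wcount-split (suc N) w p q = begin
    h p + wcount N (w ∘ suc) (p ∘ suc)
      ≡⟨ cong₂ _+_ (head (p 0) (q 0)) (wcount-split N (w ∘ suc) (p ∘ suc) (q ∘ suc)) ⟩
    (h (p ∩ₚ q) + h (p ∩ₚ ∁ₚ q)) + (wcount N (w ∘ suc) ((p ∩ₚ q) ∘ suc) + wcount N (w ∘ suc) ((p ∩ₚ ∁ₚ q) ∘ suc))
      ≡⟨ interchange +-commutativeSemigroup (h (p ∩ₚ q)) (h (p ∩ₚ ∁ₚ q)) _ _ ⟩
    (h (p ∩ₚ q) + wcount N (w ∘ suc) ((p ∩ₚ q) ∘ suc)) + (h (p ∩ₚ ∁ₚ q) + wcount N (w ∘ suc) ((p ∩ₚ ∁ₚ q) ∘ suc)) ∎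
    where
    open ≡-Reasoning
    h : (ℕ → Bool) → ℕ
    h r = if r 0 then w 0 else 0
    head : ∀ x y → (if x then w 0 else 0) ≡ (if x ∧ y then w 0 else 0) + (if x ∧ not y then w 0 else 0)
    head true  true  = sym (+-identityʳ _)
    head true  false = refl
    head false _     = refl

  weight≤wcount : ∀ N w p {k} → k < N → T (p k) → w k ≤ wcount N w p
  weight≤wcount (suc N) w p {zero}  _         p0 with p 0
  ... | true  = m≤m+n (w 0) _
  ... | false = ⊥-elim p0
  weight≤wcount (suc N) w p {suc k} (s<s k<N) pk =
    ≤-trans (weight≤wcount N (w ∘ suc) (p ∘ suc) k<N pk) (m≤n+m _ _)

  ⊆⇒∩≐ : ∀ {N p q} → p ⊆[ N ] q → q ∩ₚ p ≐[ N ] p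
  ⊆⇒∩≐ p⊆q k<N = T-⇔⇒≡ (proj₂ ∘ to T-∧) (λ pk → from T-∧ (p⊆q k<N pk , pk))

  wcount-⊆ : ∀ N w {p q} → p ⊆[ N ] q → wcount N w q ≡ wcount N w p + wcount N w (q ∩ₚ ∁ₚ p)
  wcount-⊆ N w {p} {q} p⊆q =
    trans (wcount-split N w q p) (cong (_+ wcount N w (q ∩ₚ ∁ₚ p)) (wcount-cong N w (⊆⇒∩≐ p⊆q)))

  wcount-mono : ∀ N w {p q} → p ⊆[ N ] q → wcount N w p ≤ wcount N w q
  wcount-mono N w p⊆q = ≤-trans (m≤m+n _ _) (≤-reflexive (sym (wcount-⊆ N w p⊆q)))

  wcount-⊆-≥⇒⊇ : ∀ N w {p q} → (∀ {k} → k < N → 0 < w k) →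
                 p ⊆[ N ] q → wcount N w q ≤ wcount N w p → q ⊆[ N ] p
  wcount-⊆-≥⇒⊇ N w {p} {q} w>0 p⊆q q≤p {k} k<N qk = decidable-stable (T? (p k)) λ ¬pk →
    <⇒≱ (<-≤-trans (w>0 k<N) (weight≤wcount N w (q ∩ₚ ∁ₚ p) k<N (from T-∧ (qk , not⁺ ¬pk)))) rest≤0
    where
    open ≤-Reasoning
    rest≤0 : wcount N w (q ∩ₚ ∁ₚ p) ≤ 0
    rest≤0 = +-cancelˡ-≤ (wcount N w p) _ 0 (begin
      wcount N w p + wcount N w (q ∩ₚ ∁ₚ p)  ≡⟨ wcount-⊆ N w p⊆q ⟨
      wcount N w q                          ≤⟨ q≤p ⟩
      wcount N w p                          ≡⟨ +-identityʳ _ ⟨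
      wcount N w p + 0                      ∎)

  count-all : ∀ N → count N (const true) ≡ N
  count-all zero    = refl
  count-all (suc N) = cong suc (count-all N)

  count-∁ : ∀ N p → count N (∁ₚ p) ≡ N ∸ count N p
  count-∁ N p = begin
    count N (∁ₚ p)                      ≡⟨ m+n∸m≡n (count N p) _ ⟨
    count N p + count N (∁ₚ p) ∸ count N p ≡⟨ cong (_∸ count N p) (wcount-split N (const 1) (const true) p) ⟨
    count N (const true) ∸ count N p    ≡⟨ cong (_∸ count N p) (count-all N) ⟩
    N ∸ count N p                       ∎
    where open ≡-Reasoning

  -- Opaque, so that lo and hi can be inferred from a membership proof.
  opaque
    interval : ℕ → ℕ → ℕ → Bool
    interval lo hi k = (lo ≤ᵇ k) ∧ (k <ᵇ hi)

    interval⁺ : ∀ {lo hi k} → lo ≤ k → k < hi → T (interval lo hi k)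
    interval⁺ lo≤k k<hi = from T-∧ (≤⇒≤ᵇ lo≤k , <⇒<ᵇ k<hi)

    interval⁻ : ∀ {lo hi k} → T (interval lo hi k) → lo ≤ k × k < hi
    interval⁻ {lo} {hi} {k} i with to T-∧ i
    ... | lo≤k , k<hi = ≤ᵇ⇒≤ lo k lo≤k , <ᵇ⇒< k hi k<hi

    count-interval : ∀ N lo hi → hi ≤ N → count N (interval lo hi) ≡ hi ∸ lo
    count-interval zero    lo zero z≤n = sym (0∸n≡0 lo)
    count-interval (suc N) lo hi hi≤N = begin
      h lo hi + count N (interval lo hi ∘ suc)
        ≡⟨ cong (h lo hi +_) (wcount-cong N (const 1) (λ {k} _ → interval-suc lo hi k)) ⟩
      h lo hi + count N (interval (pred lo) (pred hi))
        ≡⟨ cong (h lo hi +_) (count-interval N (pred lo) (pred hi) (pred-mono-≤ hi≤N)) ⟩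
      h lo hi + (pred hi ∸ pred lo)
        ≡⟨ h+pred∸pred lo hi ⟩
      hi ∸ lo ∎
      where
      open ≡-Reasoning
      h : ℕ → ℕ → ℕ
      h lo hi = if interval lo hi 0 then 1 else 0
      interval-suc : ∀ lo hi k → interval lo hi (suc k) ≡ interval (pred lo) (pred hi) k
      interval-suc zero           zero     k = refl
      interval-suc zero           (suc hi) k = refl
      interval-suc (suc zero)     zero     k = refl
      interval-suc (suc zero)     (suc hi) k = refl
      interval-suc (suc (suc lo)) zero     k = refl
      interval-suc (suc (suc lo)) (suc hi) k = refl
      h+pred∸pred : ∀ lo hi → h lo hi + (pred hi ∸ pred lo) ≡ hi ∸ lo
      h+pred∸pred zero    zero    = refl
      h+pred∸pred zero    (suc _) = refl
      h+pred∸pred (suc l) zero    = 0∸n≡0 l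
      h+pred∸pred (suc _) (suc _) = refl

  outside : ℕ → ℕ → ℕ → Bool
  outside lo hi = ∁ₚ (interval lo hi)

  module _ {lo hi k : ℕ} where

    outside⁺ˡ : k < lo → T (outside lo hi k)
    outside⁺ˡ k<lo = not⁺ (λ i → <⇒≱ k<lo (proj₁ (interval⁻ i)))

    outside⁺ʳ : hi ≤ k → T (outside lo hi k)
    outside⁺ʳ hi≤k = not⁺ (λ i → <⇒≱ (proj₂ (interval⁻ i)) hi≤k)

    outside⁻ : T (outside lo hi k) → k < lo ⊎ hi ≤ k
    outside⁻ o with lo ≤? k | hi ≤? k
    ... | _        | yes hi≤k = inj₂ hi≤k
    ... | no lo≰k  | no _     = inj₁ (≰⇒> lo≰k)
    ... | yes lo≤k | no hi≰k  = ⊥-elim (not⁻ o (interval⁺ lo≤k (≰⇒> hi≰k)))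

  outside-⊆ : ∀ {N lo hi lo′ hi′} → lo′ ≤ lo → hi ≤ hi′ → outside lo′ hi′ ⊆[ N ] outside lo hi
  outside-⊆ lo′≤lo hi≤hi′ _ o = [ (λ k<lo′ → outside⁺ˡ (<-≤-trans k<lo′ lo′≤lo)) ,
                                  (λ hi′≤k → outside⁺ʳ (≤-trans hi≤hi′ hi′≤k)) ]′ (outside⁻ o)

  ∩ₚ-monoˡ : ∀ {N p q} r → p ⊆[ N ] q → p ∩ₚ r ⊆[ N ] q ∩ₚ r
  ∩ₚ-monoˡ r p⊆q k<N pr with to T-∧ pr
  ... | pk , rk = from T-∧ (p⊆q k<N pk , rk)

  ∩ₚ-⊆ˡ : ∀ {N} p q → p ∩ₚ q ⊆[ N ] p
  ∩ₚ-⊆ˡ p q _ = proj₁ ∘ to T-∧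

  +-≤-tight : ∀ {a b x y} → a ≤ x → b ≤ y → x + y ≤ a + b → x ≤ a × y ≤ b
  +-≤-tight {a} {b} {x} {y} a≤x b≤y x+y≤a+b =
    +-cancelʳ-≤ y x a (≤-trans x+y≤a+b (+-monoʳ-≤ a b≤y)) ,
    +-cancelˡ-≤ x y b (≤-trans x+y≤a+b (+-monoˡ-≤ b a≤x))

  0<nCk : ∀ {n k} → k ≤ n → 0 < n choose k
  0<nCk {n}     {zero}  _         = z<s
  0<nCk {suc n} {suc k} (s≤s k≤n) =
    <-≤-trans (0<nCk k≤n) (≤-trans (m≤m+n _ _) (≤-reflexive (nCk+nC[k+1]≡[n+1]C[k+1] n k)))

  x+[m⊓n+m⊓n]≡m+n⇒x+m⊓n≡m⊔n : ∀ x m n → x + (m ⊓ n + m ⊓ n) ≡ m + n → x + m ⊓ n ≡ m ⊔ n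
  x+[m⊓n+m⊓n]≡m+n⇒x+m⊓n≡m⊔n x m n eq with ≤-total m n
  ... | inj₁ m≤n rewrite m≤n⇒m⊓n≡m m≤n | m≤n⇒m⊔n≡n m≤n =
    +-cancelʳ-≡ m _ _ (trans (+-assoc x m m) (trans eq (+-comm m n)))
  ... | inj₂ n≤m rewrite m≥n⇒m⊓n≡n n≤m | m≥n⇒m⊔n≡m n≤m =
    +-cancelʳ-≡ n _ _ (trans (+-assoc x n n) eq)

  m∸[n∸o]≡m∸n+o : ∀ {m n o} → n ≤ m → o ≤ n → m ∸ (n ∸ o) ≡ m ∸ n + o
  m∸[n∸o]≡m∸n+o {m} {n} {o} n≤m o≤n = +-cancelʳ-≡ (n ∸ o) _ _ (begin
    m ∸ (n ∸ o) + (n ∸ o)  ≡⟨ m∸n+n≡m (≤-trans (m∸n≤m n o) n≤m) ⟩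
    m                      ≡⟨ m∸n+n≡m n≤m ⟨
    m ∸ n + n              ≡⟨ cong (m ∸ n +_) (m+[n∸m]≡n o≤n) ⟨
    m ∸ n + (o + (n ∸ o))  ≡⟨ +-assoc (m ∸ n) o (n ∸ o) ⟨
    m ∸ n + o + (n ∸ o)    ∎)
    where open ≡-Reasoning

  record Bounds (n lo hi : ℕ) : Set where
    constructor bounds
    field
      lo≤n   : lo ≤ n
      1≤hi   : 1 ≤ hi
      hi≤1+n : hi ≤ suc n
      lo≤hi  : lo ≤ hi

  IsPeripheral : ℕ → (ℕ → Bool) → Set
  IsPeripheral n p = ∃₂ λ lo hi → Bounds n lo hi × p ≐[ suc n ] outside lo hi

  IsPeripheral-resp-≐ : ∀ {n p q} → p ≐[ suc n ] q → IsPeripheral n p → IsPeripheral n q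
  IsPeripheral-resp-≐ p≐q (lo , hi , b , p≐) = lo , hi , b , λ k<N → trans (sym (p≐q k<N)) (p≐ k<N)

  -- s is the weight set of S; outside A B and outside C D are those of innint(∁ S) and outint(S).
  -- The minimal cardinality of outint(S) appears as maximality of the gap D ∸ C.
  module OnWeights
    {n : ℕ} (s : ℕ → Bool) {k₀ : ℕ} (k₀<N : k₀ < suc n) (k₀∈s : T (s k₀))
    {A B : ℕ} (AB : Bounds n A B) (inner⊆t : outside A B ⊆[ suc n ] ∁ₚ s)
    (inner-maximal : ∀ {A′ B′} → Bounds n A′ B′ → outside A′ B′ ⊆[ suc n ] ∁ₚ s →
                     wcount (suc n) (n choose_) (outside A′ B′) ≤ wcount (suc n) (n choose_) (outside A B))
    {C D : ℕ} (CD : Bounds n C D) (s⊆outer : s ⊆[ suc n ] outside C D)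
    (gap-maximal : ∀ {C′ D′} → Bounds n C′ D′ → s ⊆[ suc n ] outside C′ D′ → D′ ∸ C′ ≤ D ∸ C)
    where

    open Bounds

    N : ℕ
    N = suc n

    t : ℕ → Bool
    t = ∁ₚ s

    μ : ℕ
    μ = A ⊓ (N ∸ B)

    middle : ℕ → Bool
    middle = interval μ (N ∸ μ)

    gap : ℕ → Bool
    gap = interval C D

    X : ℕ
    X = count N (t ∩ₚ middle)

    rim⊆t : outside μ (N ∸ μ) ⊆[ N ] t
    rim⊆t k<N = inner⊆t k<N ∘ outside-⊆ (m⊓n≤m A _) B≤N∸μ k<N
      where
      B≤N∸μ : B ≤ N ∸ μ
      B≤N∸μ = ≤-trans (≤-reflexive (sym (m∸[m∸n]≡n (hi≤1+n AB)))) (∸-monoʳ-≤ N (m⊓n≤n A _))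

    k₀∈middle : T (middle k₀)
    k₀∈middle = decidable-stable (T? _) λ ¬m → not⁻ (rim⊆t k₀<N (not⁺ ¬m)) k₀∈s

    μ≤k₀ : μ ≤ k₀
    μ≤k₀ = proj₁ (interval⁻ k₀∈middle)

    k₀<N∸μ : k₀ < N ∸ μ
    k₀<N∸μ = proj₂ (interval⁻ k₀∈middle)

    k₀≤n : k₀ ≤ n
    k₀≤n = s≤s⁻¹ k₀<N

    μ≤n : μ ≤ n
    μ≤n = ≤-trans μ≤k₀ k₀≤n

    μ+μ≤N : μ + μ ≤ N
    μ+μ≤N = ≤-trans (+-monoˡ-≤ μ (≤-trans μ≤k₀ (<⇒≤ k₀<N∸μ))) (≤-reflexive (m∸n+n≡m (m≤n⇒m≤1+n μ≤n)))

    middle-trichotomy : ∀ k → k < μ ⊎ T (middle k) ⊎ N ∸ μ ≤ k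
    middle-trichotomy k with T? (middle k)
    ... | yes m  = inj₂ (inj₁ m)
    ... | no ¬m  = map₂ inj₂ (outside⁻ (not⁺ ¬m))

    middle-full : μ ≡ 0 → ∀ {k} → k < N → T (middle k)
    middle-full μ≡0 {k} k<N rewrite μ≡0 = interval⁺ z≤n k<N

    gap⊆t : gap ⊆[ N ] t
    gap⊆t k<N g = not⁺ λ sk → not⁻ (s⊆outer k<N sk) g

    count-gap : count N gap ≡ D ∸ C
    count-gap = count-interval N C D (hi≤1+n CD)

    side : k₀ < C ⊎ D ≤ k₀
    side = outside⁻ (s⊆outer k₀<N k₀∈s)

    -- The half of the rim on the gap's side of k₀.
    rim : k₀ < C ⊎ D ≤ k₀ → ℕ → Bool
    rim (inj₁ _) = interval (N ∸ μ) N
    rim (inj₂ _) = interval 0 μ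

    count-rim : ∀ σ → count N (rim σ) ≡ μ
    count-rim (inj₁ _) = trans (count-interval N _ N ≤-refl) (m∸[m∸n]≡n (m≤n⇒m≤1+n μ≤n))
    count-rim (inj₂ _) = count-interval N 0 μ (m≤n⇒m≤1+n μ≤n)

    gap∖middle⊆rim : ∀ σ → gap ∩ₚ ∁ₚ middle ⊆[ N ] rim σ
    gap∖middle⊆rim σ {k} k<N g∖m with to T-∧ g∖m
    ... | g , ¬m with σ | interval⁻ g | outside⁻ ¬m
    ... | inj₁ k₀<C | C≤k , _   | inj₁ k<μ   = ⊥-elim (<⇒≱ k<μ (≤-trans μ≤k₀ (≤-trans (<⇒≤ k₀<C) C≤k)))
    ... | inj₁ _    | _         | inj₂ N∸μ≤k = interval⁺ N∸μ≤k k<N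
    ... | inj₂ _    | _         | inj₁ k<μ   = interval⁺ z≤n k<μ
    ... | inj₂ D≤k₀ | _ , k<D   | inj₂ N∸μ≤k = ⊥-elim (<⇒≱ (<-≤-trans k<D (≤-trans D≤k₀ (<⇒≤ k₀<N∸μ))) N∸μ≤k)

    count-gap-split : D ∸ C ≡ count N (gap ∩ₚ middle) + count N (gap ∩ₚ ∁ₚ middle)
    count-gap-split = trans (sym count-gap) (wcount-split N (const 1) gap middle)

    gap∩middle≤X : count N (gap ∩ₚ middle) ≤ X
    gap∩middle≤X = wcount-mono N (const 1) (∩ₚ-monoˡ middle gap⊆t)

    gap∖middle≤μ : ∀ σ → count N (gap ∩ₚ ∁ₚ middle) ≤ μ
    gap∖middle≤μ σ = ≤-trans (wcount-mono N (const 1) (gap∖middle⊆rim σ)) (≤-reflexive (count-rim σ))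

    gap≤X+μ : D ∸ C ≤ X + μ
    gap≤X+μ = ≤-trans (≤-reflexive count-gap-split) (+-mono-≤ gap∩middle≤X (gap∖middle≤μ side))

    module Tight (σ : k₀ < C ⊎ D ≤ k₀) (X+μ≡gap : X + μ ≡ D ∸ C) where

      tight : X ≤ count N (gap ∩ₚ middle) × μ ≤ count N (gap ∩ₚ ∁ₚ middle)
      tight = +-≤-tight gap∩middle≤X (gap∖middle≤μ σ) (≤-reflexive (trans X+μ≡gap count-gap-split))

      t∩middle⊆gap : t ∩ₚ middle ⊆[ N ] gap
      t∩middle⊆gap k<N =
        ∩ₚ-⊆ˡ gap middle k<N ∘ wcount-⊆-≥⇒⊇ N (const 1) (λ _ → z<s) (∩ₚ-monoˡ middle gap⊆t) (proj₁ tight) k<N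

      rim⊆gap : rim σ ⊆[ N ] gap
      rim⊆gap k<N =
        ∩ₚ-⊆ˡ gap (∁ₚ middle) k<N ∘
        wcount-⊆-≥⇒⊇ N (const 1) (λ _ → z<s) (gap∖middle⊆rim σ) (≤-trans (≤-reflexive (count-rim σ)) (proj₂ tight)) k<N

    t⊆gap⇒s≐outer : t ⊆[ N ] gap → s ≐[ N ] outside C D
    t⊆gap⇒s≐outer t⊆gap = ⊆-antisym s⊆outer λ k<N o →
      decidable-stable (T? _) λ ¬sk → not⁻ o (t⊆gap k<N (not⁺ ¬sk))

    gap≡⇒t-peripheral : (σ : k₀ < C ⊎ D ≤ k₀) → X + μ ≡ D ∸ C → 0 < μ → IsPeripheral n t
    gap≡⇒t-peripheral σ@(inj₁ k₀<C) X+μ≡gap 0<μ =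
      μ , C , bounds μ≤n (≤-<-trans z≤n k₀<C) (m≤n⇒m≤1+n (lo≤n CD)) (≤-trans μ≤k₀ (<⇒≤ k₀<C)) ,
      ⊆-antisym t⊆ ⊇t
      where
      open Tight σ X+μ≡gap
      n∈rim : T (rim σ n)
      n∈rim = interval⁺ (∸-monoʳ-≤ N 0<μ) ≤-refl
      D≡N : D ≡ N
      D≡N = ≤-antisym (hi≤1+n CD) (proj₂ (interval⁻ (rim⊆gap ≤-refl n∈rim)))
      t⊆ : t ⊆[ N ] outside μ C
      t⊆ {k} k<N tk with middle-trichotomy k
      ... | inj₁ k<μ            = outside⁺ˡ k<μ
      ... | inj₂ (inj₁ m)       = outside⁺ʳ (proj₁ (interval⁻ (t∩middle⊆gap k<N (from T-∧ (tk , m)))))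
      ... | inj₂ (inj₂ N∸μ≤k)  = outside⁺ʳ (proj₁ (interval⁻ (rim⊆gap k<N (interval⁺ N∸μ≤k k<N))))
      ⊇t : outside μ C ⊆[ N ] t
      ⊇t {k} k<N o with outside⁻ o
      ... | inj₁ k<μ = rim⊆t k<N (outside⁺ˡ k<μ)
      ... | inj₂ C≤k = gap⊆t k<N (interval⁺ C≤k (subst (k <_) (sym D≡N) k<N))
    gap≡⇒t-peripheral σ@(inj₂ D≤k₀) X+μ≡gap 0<μ =
      D , N ∸ μ , bounds (≤-trans D≤k₀ k₀≤n) (m<n⇒0<n∸m (s≤s μ≤n)) (m∸n≤m N μ) (≤-trans D≤k₀ (<⇒≤ k₀<N∸μ)) ,
      ⊆-antisym t⊆ ⊇t
      where
      open Tight σ X+μ≡gap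
      C≡0 : C ≡ 0
      C≡0 = n≤0⇒n≡0 (proj₁ (interval⁻ (rim⊆gap z<s (interval⁺ z≤n 0<μ))))
      t⊆ : t ⊆[ N ] outside D (N ∸ μ)
      t⊆ {k} k<N tk with middle-trichotomy k
      ... | inj₁ k<μ            = outside⁺ˡ (proj₂ (interval⁻ (rim⊆gap k<N (interval⁺ z≤n k<μ))))
      ... | inj₂ (inj₁ m)       = outside⁺ˡ (proj₂ (interval⁻ (t∩middle⊆gap k<N (from T-∧ (tk , m)))))
      ... | inj₂ (inj₂ N∸μ≤k)  = outside⁺ʳ N∸μ≤k
      ⊇t : outside D (N ∸ μ) ⊆[ N ] t
      ⊇t {k} k<N o with outside⁻ o
      ... | inj₁ k<D   = gap⊆t k<N (interval⁺ (subst (_≤ k) (sym C≡0) z≤n) k<D)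
      ... | inj₂ N∸μ≤k = rim⊆t k<N (outside⁺ʳ N∸μ≤k)

    gap≡⇒peripheral : X + μ ≡ D ∸ C → IsPeripheral n s ⊎ IsPeripheral n t
    gap≡⇒peripheral X+μ≡gap with μ ≟ 0
    ... | yes μ≡0 = inj₁ (C , D , CD , t⊆gap⇒s≐outer λ k<N tk →
                      Tight.t∩middle⊆gap side X+μ≡gap k<N (from T-∧ (tk , middle-full μ≡0 k<N)))
    ... | no μ≢0  = inj₂ (gap≡⇒t-peripheral side X+μ≡gap (n≢0⇒n>0 μ≢0))

    s-peripheral⇒gap≥ : IsPeripheral n s → X + μ ≤ D ∸ C
    s-peripheral⇒gap≥ (A₀ , B₀ , AB₀ , s≐) = begin
      X + μ                     ≡⟨ cong (X +_) μ≡0 ⟩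
      X + 0                     ≡⟨ +-identityʳ X ⟩
      X                         ≡⟨ wcount-cong N (const 1) (⊆-antisym (∩ₚ-⊆ˡ t middle) t⊆middle) ⟩
      count N t                 ≡⟨ wcount-cong N (const 1) t≐interval ⟩
      count N (interval A₀ B₀)  ≡⟨ count-interval N A₀ B₀ (hi≤1+n AB₀) ⟩
      B₀ ∸ A₀                   ≤⟨ gap-maximal AB₀ (≐⇒⊆ s≐) ⟩
      D ∸ C                     ∎
      where
      open ≤-Reasoning
      t≐interval : t ≐[ N ] interval A₀ B₀
      t≐interval k<N = trans (cong not (s≐ k<N)) (not-involutive _)
      -- A positive μ would put both 0 and n into t, while s = outside A₀ B₀ contains one of them.
      μ≡0 : μ ≡ 0
      μ≡0 = n≤0⇒n≡0 (≮⇒≥ λ 0<μ →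
        let 0∈t = rim⊆t z<s (outside⁺ˡ 0<μ)
            n∈t = rim⊆t ≤-refl (outside⁺ʳ (∸-monoʳ-≤ N 0<μ))
        in [ (λ k₀<A₀ → not⁻ 0∈t (≐⇒⊇ s≐ z<s (outside⁺ˡ (≤-<-trans z≤n k₀<A₀)))) ,
             (λ B₀≤k₀ → not⁻ n∈t (≐⇒⊇ s≐ ≤-refl (outside⁺ʳ (≤-trans B₀≤k₀ k₀≤n)))) ]′
           (outside⁻ (≐⇒⊆ s≐ k₀<N k₀∈s)))
      t⊆middle : t ⊆[ N ] t ∩ₚ middle
      t⊆middle k<N tk = from T-∧ (tk , middle-full μ≡0 k<N)

    t-peripheral⇒gap≥ : IsPeripheral n t → X + μ ≤ D ∸ C
    t-peripheral⇒gap≥ (A₀ , B₀ , AB₀ , t≐) = begin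
      X + μ          ≡⟨ x+[m⊓n+m⊓n]≡m+n⇒x+m⊓n≡m⊔n X A (N ∸ B) (trans (sym count-t-by-middle) count-t) ⟩
      A ⊔ (N ∸ B)    ≤⟨ ⊔-lub A≤gap N∸B≤gap ⟩
      D ∸ C          ∎
      where
      open ≤-Reasoning
      -- t contains the inner interval, which has maximal size among peripheral subsets of t.
      t⊆inner : t ⊆[ N ] outside A B
      t⊆inner k<N tk =
        wcount-⊆-≥⇒⊇ N (n choose_) (λ k<N → 0<nCk (s≤s⁻¹ k<N)) (λ k<N → ≐⇒⊆ t≐ k<N ∘ inner⊆t k<N)
          (inner-maximal AB₀ (≐⇒⊇ t≐)) k<N (≐⇒⊆ t≐ k<N tk)
      s≐interval : s ≐[ N ] interval A B
      s≐interval k<N = trans (sym (not-involutive _)) (trans (cong not (⊆-antisym t⊆inner inner⊆t k<N)) (not-involutive _))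
      count-t : count N t ≡ A + (N ∸ B)
      count-t = begin-equality
        count N t                    ≡⟨ wcount-cong N (const 1) (⊆-antisym t⊆inner inner⊆t) ⟩
        count N (outside A B)        ≡⟨ count-∁ N (interval A B) ⟩
        N ∸ count N (interval A B)   ≡⟨ cong (N ∸_) (count-interval N A B (hi≤1+n AB)) ⟩
        N ∸ (B ∸ A)                  ≡⟨ m∸[n∸o]≡m∸n+o (hi≤1+n AB) (lo≤hi AB) ⟩
        N ∸ B + A                    ≡⟨ +-comm (N ∸ B) A ⟩
        A + (N ∸ B)                  ∎
      count-t-by-middle : count N t ≡ X + (μ + μ)
      count-t-by-middle = begin-equality
        count N t                                ≡⟨ wcount-split N (const 1) t middle ⟩
        X + count N (t ∩ₚ ∁ₚ middle)             ≡⟨ cong (X +_) (wcount-cong N (const 1) (⊆⇒∩≐ rim⊆t)) ⟩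
        X + count N (∁ₚ middle)                  ≡⟨ cong (X +_) (count-∁ N middle) ⟩
        X + (N ∸ count N middle)                 ≡⟨ cong (λ c → X + (N ∸ c)) (count-interval N μ (N ∸ μ) (m∸n≤m N μ)) ⟩
        X + (N ∸ (N ∸ μ ∸ μ))                    ≡⟨ cong (λ c → X + (N ∸ c)) (∸-+-assoc N μ μ) ⟩
        X + (N ∸ (N ∸ (μ + μ)))                  ≡⟨ cong (X +_) (m∸[m∸n]≡n μ+μ≤N) ⟩
        X + (μ + μ)                              ∎
      A≤gap : A ≤ D ∸ C
      A≤gap with A ≟ 0
      ... | yes A≡0 = ≤-trans (≤-reflexive A≡0) z≤n
      ... | no A≢0  = gap-maximal (bounds z≤n (n≢0⇒n>0 A≢0) (m≤n⇒m≤1+n (lo≤n AB)) z≤n)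
                        λ k<N sk → outside⁺ʳ (proj₁ (interval⁻ (≐⇒⊆ s≐interval k<N sk)))
      N∸B≤gap : N ∸ B ≤ D ∸ C
      N∸B≤gap with B ≟ N
      ... | yes B≡N = ≤-trans (≤-reflexive (trans (cong (N ∸_) B≡N) (n∸n≡0 N))) z≤n
      ... | no B≢N  = gap-maximal (bounds (s≤s⁻¹ (≤∧≢⇒< (hi≤1+n AB) B≢N)) z<s ≤-refl (hi≤1+n AB))
                        λ k<N sk → outside⁺ˡ (proj₂ (interval⁻ (≐⇒⊆ s≐interval k<N sk)))

    peripheral⇒gap≥ : IsPeripheral n s ⊎ IsPeripheral n t → X + μ ≤ D ∸ C
    peripheral⇒gap≥ = [ s-peripheral⇒gap≥ , t-peripheral⇒gap≥ ]′


  ⟦_⟧ : ∀ {N} → Vec Bool N → ℕ → Bool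
  ⟦ [] ⟧    _       = false
  ⟦ x ∷ v ⟧ zero    = x
  ⟦ x ∷ v ⟧ (suc k) = ⟦ v ⟧ k

  ∈⇒T⟦⟧ : ∀ {N} {v : Vec Bool N} {i} → i ∈ v → T (⟦ v ⟧ (toℕ i))
  ∈⇒T⟦⟧ here        = tt
  ∈⇒T⟦⟧ (there i∈v) = ∈⇒T⟦⟧ i∈v

  T⟦⟧⇒∈ : ∀ {N} (v : Vec Bool N) {k} (k<N : k < N) → T (⟦ v ⟧ k) → fromℕ< k<N ∈ v
  T⟦⟧⇒∈ (true  ∷ v) {zero}  _         _  = here
  T⟦⟧⇒∈ (x     ∷ v) {suc k} (s<s k<N) vk = there (T⟦⟧⇒∈ v k<N vk)

  ⊆⇒⊆[] : ∀ {N} {u v : Vec Bool N} → u ⊆ v → ⟦ u ⟧ ⊆[ N ] ⟦ v ⟧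
  ⊆⇒⊆[] {u = u} {v} u⊆v k<N uk = subst (T ∘ ⟦ v ⟧) (toℕ-fromℕ< k<N) (∈⇒T⟦⟧ (u⊆v (T⟦⟧⇒∈ u k<N uk)))

  ⊆[]⇒⊆ : ∀ {N} {u v : Vec Bool N} → ⟦ u ⟧ ⊆[ N ] ⟦ v ⟧ → u ⊆ v
  ⊆[]⇒⊆ {v = v} u⊆v {i} i∈u =
    subst (_∈ v) (fromℕ<-toℕ i (toℕ<n i)) (T⟦⟧⇒∈ v (toℕ<n i) (u⊆v (toℕ<n i) (∈⇒T⟦⟧ i∈u)))

  ≐⇒≡ : ∀ {N} (u v : Vec Bool N) → ⟦ u ⟧ ≐[ N ] ⟦ v ⟧ → u ≡ v
  ≐⇒≡ []      []      _   = refl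
  ≐⇒≡ (x ∷ u) (y ∷ v) u≐v = cong₂ _∷_ (u≐v z<s) (≐⇒≡ u v (u≐v ∘ s<s))

  ∣∣≡count : ∀ {N} (v : Vec Bool N) → ∣ v ∣ ≡ count N ⟦ v ⟧
  ∣∣≡count []          = refl
  ∣∣≡count (true  ∷ v) = cong suc (∣∣≡count v)
  ∣∣≡count (false ∷ v) = ∣∣≡count v

  sum-tabulate≡wcount : ∀ {N} w (v : Vec Bool N) →
                        sum (tabulate λ i → if lookup v i then w (toℕ i) else 0) ≡ wcount N w ⟦ v ⟧
  sum-tabulate≡wcount w []      = refl
  sum-tabulate≡wcount w (x ∷ v) = cong ((if x then w 0 else 0) +_) (sum-tabulate≡wcount (w ∘ suc) v)

  ⟦tabulate⟧ : ∀ {N} (g : ℕ → Bool) → ⟦ tabulate {n = N} (g ∘ toℕ) ⟧ ≐[ N ] g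
  ⟦tabulate⟧ {suc N} g {zero}  _         = refl
  ⟦tabulate⟧ {suc N} g {suc k} (s<s k<N) = ⟦tabulate⟧ (g ∘ suc) k<N

  ⟦∁⟧ : ∀ {N} (v : Vec Bool N) → ⟦ ∁ v ⟧ ≐[ N ] ∁ₚ ⟦ v ⟧
  ⟦∁⟧ (x ∷ v) {zero}  _         = refl
  ⟦∁⟧ (x ∷ v) {suc k} (s<s k<N) = ⟦∁⟧ v k<N

  ⟦∩⟧ : ∀ {N} (u v : Vec Bool N) → ⟦ u ∩ v ⟧ ≐[ N ] ⟦ u ⟧ ∩ₚ ⟦ v ⟧
  ⟦∩⟧ (x ∷ u) (y ∷ v) {zero}  _         = refl
  ⟦∩⟧ (x ∷ u) (y ∷ v) {suc k} (s<s k<N) = ⟦∩⟧ u v k<N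

open WeightSets
open import Data.Bool using (not; _∧_; _∨_; T)
open import Data.Bool.Properties using (T-∨)
open import Data.Fin.Properties using (toℕ<n)
open import Data.Fin.Subset using (Nonempty; _⊆_; ∁; _∩_; ∣_∣; ⊤; _∈_)
open import Data.Fin.Subset.Properties using (∈⊤; x∈p⇒x∉∁p)
open import Data.Integer using (ℤ; +_; -[1+_]; _+_; _-_; _⊖_; _⊓_; _≥_)
import Data.Integer as ℤ
import Data.Integer.Properties as ℤₚ
open import Data.Integer.Tactic.RingSolver using (solve-∀)
open import Data.Nat as ℕ using (ℕ; zero; suc; z≤n; s≤s)
open import Data.Nat.Combinatorics using () renaming (_C_ to _choose_)
import Data.Nat.Properties as ℕₚ
open import Data.Product using (_×_; _,_; proj₁; proj₂; ∃₂)
open import Data.Sum using (_⊎_; inj₁; inj₂; [_,_]′)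
open import Function using (_∘_; const; _⇔_; mk⇔; Equivalence)
open import Relation.Binary.PropositionalEquality
open import Relation.Nullary using (¬_; Dec)
open import Relation.Nullary.Decidable using (⌊_⌋; toWitness; fromWitness)

open Equivalence using (to; from)

-- In the coordinates a = A − 1, b = B the weight set I n a b of J_{n,a,b} is outside A B.
pred⁺ : ℕ → ℤ
pred⁺ zero    = -[1+ 0 ]
pred⁺ (suc A) = + A

decode : ∀ {n a b} → Valid n a b → ∃₂ λ A B → a ≡ pred⁺ A × b ≡ + B
decode {a = -[1+ 0 ]} {+ B} _ = 0 , B , refl , refl
decode {a = + A}      {+ B} _ = suc A , B , refl , refl
decode {a = -[1+ suc _ ]} (ℤ.-≤- () , _)
decode {b = -[1+ _ ]}     (_ , _ , () , _)

Valid⇒Bounds : ∀ {n A B} → Valid n (pred⁺ A) (+ B) → Bounds n A B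
Valid⇒Bounds {A = zero}  (_ , _ , ℤ.+≤+ 1≤B , ℤ.+≤+ B≤N , _) = bounds z≤n 1≤B B≤N z≤n
Valid⇒Bounds {A = suc _} (_ , ℤ.+<+ A≤n , ℤ.+≤+ 1≤B , ℤ.+≤+ B≤N , ℤ.+<+ A≤B) = bounds A≤n 1≤B B≤N A≤B

Bounds⇒Valid : ∀ {n A B} → Bounds n A B → Valid n (pred⁺ A) (+ B)
Bounds⇒Valid {A = zero}  (bounds _ 1≤B B≤N _) = ℤₚ.≤-refl , ℤ.-<+ , ℤ.+≤+ 1≤B , ℤ.+≤+ B≤N , ℤ.-<+
Bounds⇒Valid {A = suc _} (bounds A≤n 1≤B B≤N A≤B) = ℤ.-≤+ , ℤ.+<+ A≤n , ℤ.+≤+ 1≤B , ℤ.+≤+ B≤N , ℤ.+<+ A≤B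

+≤pred⁺⇒< : ∀ {k A} → + k ℤ.≤ pred⁺ A → k ℕ.< A
+≤pred⁺⇒< {A = zero}  ()
+≤pred⁺⇒< {A = suc _} (ℤ.+≤+ k≤a) = s≤s k≤a

<⇒+≤pred⁺ : ∀ {k A} → k ℕ.< A → + k ℤ.≤ pred⁺ A
<⇒+≤pred⁺ {A = suc _} (s≤s k≤a) = ℤ.+≤+ k≤a

⟦I⟧ : ∀ n A B → ⟦ I n (pred⁺ A) (+ B) ⟧ ≐[ suc n ] outside A B
⟦I⟧ n A B {k} k<N = trans (⟦tabulate⟧ (λ k → ⌊ + k ℤ.≤? pred⁺ A ⌋ ∨ ⌊ + B ℤ.≤? + k ⌋) k<N) (T-⇔⇒≡ ⇒outside outside⇒)
  where
  k≤a? : Dec (+ k ℤ.≤ pred⁺ A)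
  k≤a? = + k ℤ.≤? pred⁺ A
  b≤k? : Dec (+ B ℤ.≤ + k)
  b≤k? = + B ℤ.≤? + k
  ⇒outside : T (⌊ k≤a? ⌋ ∨ ⌊ b≤k? ⌋) → T (outside A B k)
  ⇒outside i with to (T-∨ {⌊ k≤a? ⌋}) i
  ... | inj₁ k≤a = outside⁺ˡ (+≤pred⁺⇒< (toWitness {a? = k≤a?} k≤a))
  ... | inj₂ b≤k = outside⁺ʳ (ℤₚ.drop‿+≤+ (toWitness {a? = b≤k?} b≤k))
  outside⇒ : T (outside A B k) → T (⌊ k≤a? ⌋ ∨ ⌊ b≤k? ⌋)
  outside⇒ o with outside⁻ o
  ... | inj₁ k<A = from (T-∨ {⌊ k≤a? ⌋}) (inj₁ (fromWitness {a? = k≤a?} (<⇒+≤pred⁺ k<A)))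
  ... | inj₂ B≤k = from (T-∨ {⌊ k≤a? ⌋}) (inj₂ (fromWitness {a? = b≤k?} (ℤ.+≤+ B≤k)))

⊖≡pred⁺∸ : ∀ m k → k ℕ.≤ suc m → m ⊖ k ≡ pred⁺ (suc m ℕ.∸ k)
⊖≡pred⁺∸ m       zero          _           = refl
⊖≡pred⁺∸ zero    (suc zero)    _           = refl
⊖≡pred⁺∸ (suc m) (suc k)       (s≤s k≤1+m) = trans (ℤₚ.[1+m]⊖[1+n]≡m⊖n m k) (⊖≡pred⁺∸ m k k≤1+m)
⊖≡pred⁺∸ zero    (suc (suc k)) (s≤s ())

-≡pred⁺∸ : ∀ n k → k ℕ.≤ suc n → + n - + k ≡ pred⁺ (suc n ℕ.∸ k)
-≡pred⁺∸ n k k≤1+n = trans (ℤₚ.m-n≡m⊖n n k) (⊖≡pred⁺∸ n k k≤1+n)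

pred⁺<+⇒≤ : ∀ {x k} → pred⁺ x ℤ.< + k → x ℕ.≤ k
pred⁺<+⇒≤ {zero}  _            = z≤n
pred⁺<+⇒≤ {suc x} (ℤ.+<+ x<k) = x<k

≤⇒pred⁺<+ : ∀ {x k} → x ℕ.≤ k → pred⁺ x ℤ.< + k
≤⇒pred⁺<+ {zero}  _   = ℤ.-<+
≤⇒pred⁺<+ {suc x} x<k = ℤ.+<+ x<k

⟦∁Wni⟧ : ∀ n μ → μ ℕ.≤ suc n → ⟦ ∁ (Wni n (+ μ)) ⟧ ≐[ suc n ] interval μ (suc n ℕ.∸ μ)
⟦∁Wni⟧ n μ μ≤N {k} k<N =
  trans (⟦∁⟧ (Wni n (+ μ)) k<N)
        (trans (cong not (⟦tabulate⟧ (λ k → ⌊ + k ℤ.<? + μ ⌋ ∨ ⌊ (+ n - + μ) ℤ.<? + k ⌋) k<N))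
               (T-⇔⇒≡ ⇒interval interval⇒))
  where
  k<μ? : Dec (+ k ℤ.< + μ)
  k<μ? = + k ℤ.<? + μ
  r<k? : Dec (+ n - + μ ℤ.< + k)
  r<k? = (+ n - + μ) ℤ.<? + k
  r<k⇒N∸μ≤k : + n - + μ ℤ.< + k → suc n ℕ.∸ μ ℕ.≤ k
  r<k⇒N∸μ≤k r<k = pred⁺<+⇒≤ (subst (ℤ._< + k) (-≡pred⁺∸ n μ μ≤N) r<k)
  ⇒interval : T (not (⌊ k<μ? ⌋ ∨ ⌊ r<k? ⌋)) → T (interval μ (suc n ℕ.∸ μ) k)
  ⇒interval w = interval⁺
    (ℕₚ.≮⇒≥ λ k<μ → not⁻ w (from (T-∨ {⌊ k<μ? ⌋}) (inj₁ (fromWitness {a? = k<μ?} (ℤ.+<+ k<μ)))))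
    (ℕₚ.≰⇒> λ N∸μ≤k → not⁻ w (from (T-∨ {⌊ k<μ? ⌋}) (inj₂ (fromWitness {a? = r<k?}
      (subst (ℤ._< + k) (sym (-≡pred⁺∸ n μ μ≤N)) (≤⇒pred⁺<+ N∸μ≤k))))))
  interval⇒ : T (interval μ (suc n ℕ.∸ μ) k) → T (not (⌊ k<μ? ⌋ ∨ ⌊ r<k? ⌋))
  interval⇒ i = not⁺ λ w → [ (λ k<μ → ℕₚ.<⇒≱ (ℤₚ.drop‿+<+ (toWitness {a? = k<μ?} k<μ)) (proj₁ (interval⁻ i))) ,
                             (λ r<k → ℕₚ.<⇒≱ (proj₂ (interval⁻ i)) (r<k⇒N∸μ≤k (toWitness {a? = r<k?} r<k))) ]′
                           (to (T-∨ {⌊ k<μ? ⌋}) w)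

pred⁺-⊓ : ∀ x y → pred⁺ x ⊓ pred⁺ y ≡ pred⁺ (x ℕ.⊓ y)
pred⁺-⊓ zero    zero    = refl
pred⁺-⊓ zero    (suc y) = refl
pred⁺-⊓ (suc x) zero    = refl
pred⁺-⊓ (suc x) (suc y) = refl

pred⁺+1 : ∀ x → pred⁺ x + + 1 ≡ + x
pred⁺+1 zero    = refl
pred⁺+1 (suc x) = cong +_ (ℕₚ.+-comm x 1)

pred⁺≡-1 : ∀ x → pred⁺ x ≡ + x - + 1
pred⁺≡-1 zero    = refl
pred⁺≡-1 (suc x) = refl

size-I : ∀ n A B → size n (I n (pred⁺ A) (+ B)) ≡ wcount (suc n) (n choose_) (outside A B)
size-I n A B =
  trans (sum-tabulate≡wcount (n choose_) (I n (pred⁺ A) (+ B))) (wcount-cong (suc n) (n choose_) (⟦I⟧ n A B))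

∣I∣ : ∀ n A B → B ℕ.≤ suc n → ∣ I n (pred⁺ A) (+ B) ∣ ≡ suc n ℕ.∸ (B ℕ.∸ A)
∣I∣ n A B B≤N = begin
  ∣ I n (pred⁺ A) (+ B) ∣                   ≡⟨ ∣∣≡count (I n (pred⁺ A) (+ B)) ⟩
  count (suc n) ⟦ I n (pred⁺ A) (+ B) ⟧     ≡⟨ wcount-cong (suc n) (const 1) (⟦I⟧ n A B) ⟩
  count (suc n) (outside A B)               ≡⟨ count-∁ (suc n) (interval A B) ⟩
  suc n ℕ.∸ count (suc n) (interval A B)    ≡⟨ cong (suc n ℕ.∸_) (count-interval (suc n) A B B≤N) ⟩
  suc n ℕ.∸ (B ℕ.∸ A)                       ∎
  where open ≡-Reasoning

peripheral⇔ : ∀ n (V : SymSet n) → Peripheral n V ⇔ IsPeripheral n ⟦ V ⟧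
peripheral⇔ n V = mk⇔ ⇒IsPeripheral IsPeripheral⇒
  where
  ⇒IsPeripheral : Peripheral n V → IsPeripheral n ⟦ V ⟧
  ⇒IsPeripheral (a , b , valid , V≡I) with decode valid
  ... | A , B , refl , refl =
    A , B , Valid⇒Bounds valid , λ k<N → trans (cong (λ W → ⟦ W ⟧ _) V≡I) (⟦I⟧ n A B k<N)
  IsPeripheral⇒ : IsPeripheral n ⟦ V ⟧ → Peripheral n V
  IsPeripheral⇒ (A , B , AB , V≐) =
    pred⁺ A , + B , Bounds⇒Valid AB , ≐⇒≡ V (I n (pred⁺ A) (+ B)) λ k<N → trans (V≐ k<N) (sym (⟦I⟧ n A B k<N))

nonempty⇒∁≢⊤ : ∀ {n} {S : SymSet n} → Nonempty S → ¬ (∁ S ≡ ⊤)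
nonempty⇒∁≢⊤ (i , i∈S) ∁S≡⊤ = x∈p⇒x∉∁p i∈S (subst (i ∈_) (sym ∁S≡⊤) ∈⊤)

+[m∸n+o]≡+o⇔m≤n : ∀ m n o → (+ (m ℕ.∸ n ℕ.+ o) ≡ + o) ⇔ m ℕ.≤ n
+[m∸n+o]≡+o⇔m≤n m n o = mk⇔
  (λ eq → ℕₚ.m∸n≡0⇒m≤n (ℕₚ.+-cancelʳ-≡ o _ 0 (ℤₚ.+-injective eq)))
  (λ m≤n → cong (λ d → + (d ℕ.+ o)) (ℕₚ.m≤n⇒m∸n≡0 m≤n))

module Decoded (n : ℕ) (S : SymSet n) (S≢∅ : Nonempty S) {A B C D : ℕ}
  (inner : IsInnint n (∁ S) (pred⁺ A) (+ B)) (outer : IsOutint n S (pred⁺ C) (+ D)) where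

  open Bounds

  ∁S≢⊤ : ¬ (∁ S ≡ ⊤)
  ∁S≢⊤ = nonempty⇒∁≢⊤ S≢∅

  I-maximal : ∀ a′ b′ → Valid n a′ b′ → I n a′ b′ ⊆ ∁ S → size n (I n a′ b′) ℕ.≤ size n (I n (pred⁺ A) (+ B))
  I-maximal = proj₂ (proj₂ (proj₂ inner ∁S≢⊤))

  I-minimal : ∀ c′ d′ → Valid n c′ d′ → S ⊆ I n c′ d′ → ∣ I n (pred⁺ C) (+ D) ∣ ℕ.≤ ∣ I n c′ d′ ∣
  I-minimal = proj₂ (proj₂ (proj₁ outer))

  AB : Bounds n A B
  AB = Valid⇒Bounds (proj₁ (proj₂ inner ∁S≢⊤))

  CD : Bounds n C D
  CD = Valid⇒Bounds (proj₁ (proj₁ outer))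

  inner⊆t : outside A B ⊆[ suc n ] ∁ₚ ⟦ S ⟧
  inner⊆t = ⊆-resp-≐ (⟦I⟧ n A B) (⟦∁⟧ S) (⊆⇒⊆[] (proj₁ (proj₂ (proj₂ inner ∁S≢⊤))))

  inner-maximal : ∀ {A′ B′} → Bounds n A′ B′ → outside A′ B′ ⊆[ suc n ] ∁ₚ ⟦ S ⟧ →
                  wcount (suc n) (n choose_) (outside A′ B′) ℕ.≤ wcount (suc n) (n choose_) (outside A B)
  inner-maximal {A′} {B′} A′B′ ⊆t = subst₂ ℕ._≤_ (size-I n A′ B′) (size-I n A B)
    (I-maximal (pred⁺ A′) (+ B′) (Bounds⇒Valid A′B′)
      (⊆[]⇒⊆ (⊆-resp-≐ (≐-sym (⟦I⟧ n A′ B′)) (≐-sym (⟦∁⟧ S)) ⊆t)))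

  s⊆outer : ⟦ S ⟧ ⊆[ suc n ] outside C D
  s⊆outer = ⊆-resp-≐ (λ _ → refl) (⟦I⟧ n C D) (⊆⇒⊆[] (proj₁ (proj₂ (proj₁ outer))))

  gap-maximal : ∀ {C′ D′} → Bounds n C′ D′ → ⟦ S ⟧ ⊆[ suc n ] outside C′ D′ → D′ ℕ.∸ C′ ℕ.≤ D ℕ.∸ C
  gap-maximal {C′} {D′} C′D′ S⊆ = ℕₚ.∸-cancelʳ-≤ (ℕₚ.≤-trans (ℕₚ.m∸n≤m D′ C′) (hi≤1+n C′D′))
    (subst₂ ℕ._≤_ (∣I∣ n C D (hi≤1+n CD)) (∣I∣ n C′ D′ (hi≤1+n C′D′))
      (I-minimal (pred⁺ C′) (+ D′) (Bounds⇒Valid C′D′)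
        (⊆[]⇒⊆ (⊆-resp-≐ (λ _ → refl) (≐-sym (⟦I⟧ n C′ D′)) S⊆))))

  open OnWeights ⟦ S ⟧ (toℕ<n (proj₁ S≢∅)) (∈⇒T⟦⟧ (proj₂ S≢∅)) AB inner⊆t inner-maximal CD s⊆outer gap-maximal

  inn≡ : inn n (∁ S) (pred⁺ A) (+ B) ≡ + (X ℕ.+ μ)
  inn≡ = begin
    inn n (∁ S) (pred⁺ A) (+ B)
      ≡⟨ cong (λ m → m + + ∣ ∁ S ∩ ∁ (Wni n m) ∣) cut≡μ ⟩
    + μ + + ∣ ∁ S ∩ ∁ (Wni n (+ μ)) ∣
      ≡⟨ cong (λ x → + (μ ℕ.+ x)) (trans (∣∣≡count (∁ S ∩ ∁ (Wni n (+ μ)))) (wcount-cong (suc n) (const 1) ⟦∁S∩middle⟧)) ⟩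
    + (μ ℕ.+ X)
      ≡⟨ cong +_ (ℕₚ.+-comm μ X) ⟩
    + (X ℕ.+ μ) ∎
    where
    open ≡-Reasoning
    cut≡μ : pred⁺ A ⊓ (+ n - + B) + + 1 ≡ + μ
    cut≡μ = begin
      pred⁺ A ⊓ (+ n - + B) + + 1                ≡⟨ cong (λ y → pred⁺ A ⊓ y + + 1) (-≡pred⁺∸ n B (hi≤1+n AB)) ⟩
      pred⁺ A ⊓ pred⁺ (suc n ℕ.∸ B) + + 1        ≡⟨ cong (_+ + 1) (pred⁺-⊓ A (suc n ℕ.∸ B)) ⟩
      pred⁺ μ + + 1                              ≡⟨ pred⁺+1 μ ⟩
      + μ                                        ∎
    ⟦∁S∩middle⟧ : ⟦ ∁ S ∩ ∁ (Wni n (+ μ)) ⟧ ≐[ suc n ] ∁ₚ ⟦ S ⟧ ∩ₚ middle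
    ⟦∁S∩middle⟧ k<N = trans (⟦∩⟧ (∁ S) _ k<N)
      (cong₂ _∧_ (⟦∁⟧ S k<N) (⟦∁Wni⟧ n μ (ℕₚ.m≤n⇒m≤1+n μ≤n) k<N))

  inn+out≡ : inn n (∁ S) (pred⁺ A) (+ B) + out n (pred⁺ C) (+ D) ≡ + (X ℕ.+ μ ℕ.∸ (D ℕ.∸ C) ℕ.+ n)
  inn+out≡ = begin
    inn n (∁ S) (pred⁺ A) (+ B) + (pred⁺ C + + n - + D + + 1)
      ≡⟨ cong₂ (λ i c → i + (c + + n - + D + + 1)) inn≡ (pred⁺≡-1 C) ⟩
    + (X ℕ.+ μ) + (+ C - + 1 + + n - + D + + 1)
      ≡⟨ cong (λ d → + (X ℕ.+ μ) + (+ C - + 1 + + n - d + + 1)) (cong +_ (sym (ℕₚ.m+[n∸m]≡n (lo≤hi CD)))) ⟩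
    + (X ℕ.+ μ) + (+ C - + 1 + + n - (+ C + + (D ℕ.∸ C)) + + 1)
      ≡⟨ rearrange (+ (X ℕ.+ μ)) (+ C) (+ n) (+ (D ℕ.∸ C)) ⟩
    + (X ℕ.+ μ) - + (D ℕ.∸ C) + + n
      ≡⟨ cong (_+ + n) (trans (ℤₚ.m-n≡m⊖n (X ℕ.+ μ) (D ℕ.∸ C)) (ℤₚ.⊖-≥ gap≤X+μ)) ⟩
    + (X ℕ.+ μ ℕ.∸ (D ℕ.∸ C) ℕ.+ n) ∎
    where
    open ≡-Reasoning
    rearrange : ∀ v c m g → v + (c - + 1 + m - (c + g) + + 1) ≡ v - g + m
    rearrange = solve-∀

  peripheral⊎peripheral⇔ : (Peripheral n S ⊎ Peripheral n (∁ S)) ⇔ (IsPeripheral n ⟦ S ⟧ ⊎ IsPeripheral n (∁ₚ ⟦ S ⟧))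
  peripheral⊎peripheral⇔ = mk⇔
    [ inj₁ ∘ to (peripheral⇔ n S) , inj₂ ∘ IsPeripheral-resp-≐ (⟦∁⟧ S) ∘ to (peripheral⇔ n (∁ S)) ]′
    [ inj₁ ∘ from (peripheral⇔ n S) , inj₂ ∘ from (peripheral⇔ n (∁ S)) ∘ IsPeripheral-resp-≐ (≐-sym (⟦∁⟧ S)) ]′

  conclusion : (inn n (∁ S) (pred⁺ A) (+ B) + out n (pred⁺ C) (+ D) ≥ + n)
               × ((inn n (∁ S) (pred⁺ A) (+ B) + out n (pred⁺ C) (+ D) ≡ + n) ⇔ (Peripheral n S ⊎ Peripheral n (∁ S)))
  conclusion =
    subst (+ n ℤ.≤_) (sym inn+out≡) (ℤ.+≤+ (ℕₚ.m≤n+m n _)) ,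
    mk⇔ (λ eq → from peripheral⊎peripheral⇔ (gap≡⇒peripheral
                  (ℕₚ.≤-antisym (to (+[m∸n+o]≡+o⇔m≤n _ _ n) (trans (sym inn+out≡) eq)) gap≤X+μ)))
        (λ per → trans inn+out≡ (from (+[m∸n+o]≡+o⇔m≤n _ _ n) (peripheral⇒gap≥ (to peripheral⊎peripheral⇔ per))))

proposition1p16 : (n : ℕ) (S : SymSet n) → Nonempty S
    → (a b c d : ℤ) → IsInnint n (∁ S) a b → IsOutint n S c d
    → (inn n (∁ S) a b + out n c d ≥ + n)
      × ((inn n (∁ S) a b + out n c d ≡ + n) ⇔ (Peripheral n S ⊎ Peripheral n (∁ S)))
proposition1p16 n S S≢∅ a b c d inner outer
  with decode (proj₁ (proj₂ inner (nonempty⇒∁≢⊤ S≢∅))) | decode (proj₁ (proj₁ outer))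
... | A , B , refl , refl | C , D , refl , refl = Decoded.conclusion n S S≢∅ inner outer
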